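{- Let $M$ be an $m\times n$ matrix with entries in $\{0,1,2\}$. Then $M$ is a (strong) lonesum matrix if and only if each of its $2\times 2$ submatrices is equivalent to one of the matrices $$\begin{pmatrix}2&2\\c&d\end{pmatrix},\quad \begin{pmatrix}2&b\\2&d\end{pmatrix},\quad \begin{pmatrix}2&b\\c&0\end{pmatrix},\quad \begin{pmatrix}a&b\\0&0\end{pmatrix},\quad \begin{pmatrix}a&0\\c&0\end{pmatrix}$$ for some $a,b,c,d\in\{0,1,2\}$.
   Context: A ternary matrix is a matrix with entries in $\{0,1,2\}$. A ternary $m\times n$ matrix $M$ is a (strong) lonesum matrix if it is the only ternary $m\times n$ matrix having the same row sums and the same column sums as $M$. A $2\times 2$ submatrix of $M$ is the matrix formed by the entries in two chosen rows and two chosen columns of $M$ (keeping their order). Two matrices $N,N'$ are equivalent if $N'=PNP'$ for some permutation matrices $P,P'$, i.e. $N'$ is obtained from $N$ by permuting rows and permuting columns. -}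

module Defs where

open import Data.Nat using (ℕ; _+_)
open import Data.Fin using (Fin; toℕ; _<_; zero; suc)
open import Data.Product using (Σ; ∃; _×_; _,_)
open import Data.Sum using (_⊎_)
open import Data.Fin.Permutation using (Permutation′; _⟨$⟩ʳ_)
open import Relation.Binary.PropositionalEquality using (_≡_)

TMatrix : ℕ → ℕ → Set
TMatrix m n = Fin m → Fin n → Fin 3

sumFin : (k : ℕ) → (Fin k → ℕ) → ℕ
sumFin ℕ.zero f = 0
sumFin (ℕ.suc k) f = f zero + sumFin k (λ i → f (suc i))

rowSum : ∀ {m n} → TMatrix m n → Fin m → ℕ
rowSum {m} {n} M i = sumFin n (λ j → toℕ (M i j))

colSum : ∀ {m n} → TMatrix m n → Fin n → ℕ
colSum {m} {n} M j = sumFin m (λ i → toℕ (M i j))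

Lonesum : ∀ {m n} → TMatrix m n → Set
Lonesum {m} {n} M =
  (N : TMatrix m n) →
  (∀ i → rowSum N i ≡ rowSum M i) →
  (∀ j → colSum N j ≡ colSum M j) →
  ∀ i j → N i j ≡ M i j

M2 : Set
M2 = Fin 2 → Fin 2 → Fin 3

mk2 : Fin 3 → Fin 3 → Fin 3 → Fin 3 → M2
mk2 a b c d zero zero = a
mk2 a b c d zero (suc zero) = b
mk2 a b c d (suc zero) zero = c
mk2 a b c d (suc zero) (suc zero) = d

sub2 : ∀ {m n} → TMatrix m n → Fin m → Fin m → Fin n → Fin n → M2
sub2 M i₁ i₂ j₁ j₂ = mk2 (M i₁ j₁) (M i₁ j₂) (M i₂ j₁) (M i₂ j₂)

-- N' is equivalent to N: N' = P N P' for permutation matrices P, P'.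
Equiv2 : M2 → M2 → Set
Equiv2 N' N = Σ (Permutation′ 2) λ σ → Σ (Permutation′ 2) λ τ →
  ∀ r c → N' r c ≡ N (σ ⟨$⟩ʳ r) (τ ⟨$⟩ʳ c)

two one zero3 : Fin 3
two = suc (suc zero)
one = suc zero
zero3 = zero

_≐_ : M2 → M2 → Set
N ≐ N' = ∀ r c → N r c ≡ N' r c

Pattern : M2 → Set
Pattern N =
     (∃ λ c → ∃ λ d → N ≐ mk2 two two c d)
  ⊎ (∃ λ b → ∃ λ d → N ≐ mk2 two b two d)
  ⊎ (∃ λ b → ∃ λ c → N ≐ mk2 two b c zero3)
  ⊎ (∃ λ a → ∃ λ b → N ≐ mk2 a b zero3 zero3)
  ⊎ (∃ λ a → ∃ λ c → N ≐ mk2 a zero3 c zero3)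

Admissible : M2 → Set
Admissible N = ∃ λ P → Pattern P × Equiv2 N P

module Submission where

-- A ternary matrix M is lonesum iff it is switch-free, where a *switch* is a
-- pair of rows a ≠ a' and columns b ≠ b' such that the entries (a,b), (a',b')
-- can be raised by one and the entries (a,b'), (a',b) lowered by one without
-- leaving {0,1,2}.
--
--  1. Exchange: performing a switch keeps all row and column sums, so a
--     lonesum matrix is switch-free.  The exchanged matrix gives every row and
--     every column a role (raise / lower / keep) and combines them
--     symmetrically, so row and column sums follow from one lemma about moving
--     a unit inside a single line.
--  2. Switch-free ⇒ lonesum: if N has the line sums of M and exceeds M
--     somewhere, choose such a row r of maximal row sum in M and follow an
--     excess–deficit alternation along a column, a row and a column.  In a
--     switch-free matrix a row that can be raised where another can be lowered
--     is dominated by it, so maximality forces the rows met to coincide, and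
--     this exhibits a switch.
--  3. Switches transfer along injective reindexings of rows and columns, hence
--     along permutations and to and from submatrices.  A 2 × 2 ternary matrix is
--     admissible iff it is switch-free; this finite fact is decided by
--     computation over all 81 such matrices.
-- The theorem combines 1–3, localising a switch of M in an ordered submatrix.

open import Defs
open import Data.Nat using (ℕ)
open import Data.Fin using (Fin; _<_)
open import Function.Bundles using (_⇔_)

open import Algebra.Properties.CommutativeSemigroup using (interchange)
open import Data.Bool using (T; if_then_else_)
open import Data.Empty using (⊥; ⊥-elim)
open import Data.Fin using (toℕ; zero; suc)
open import Data.Fin.Patterns using (0F; 1F)
open import Data.Fin.Permutation
  using (Permutation′; _⟨$⟩ʳ_; _⟨$⟩ˡ_; inverseˡ; transpose) renaming (id to idₚ)
open import Data.Fin.Properties using (_≟_; toℕ<n; toℕ-injective; any?; all?; <-cmp; <⇒≢)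
open import Data.Maybe using (Maybe; map; _<∣>_; is-just; to-witness-T)
open import Data.Nat using (zero; suc; _+_; _≤_; z≤n; s≤s; _<?_; _≤?_) renaming (_<_ to _<ℕ_)
open import Data.Nat.Properties
  using (≤-refl; ≤-trans; ≤-antisym; ≤-pred; ≮⇒≥; ≰⇒≥; ≤⇒≯; <-asym; 1+n≢n; ≤-<-trans;
         <-≤-trans; +-mono-≤; +-mono-<-≤; +-mono-≤-<; +-comm; +-identityʳ; +-cancelʳ-≡;
         +-commutativeSemigroup)
  renaming (<⇒≢ to <⇒≢ℕ)
open import Data.Product using (∃; _×_; _,_; proj₁; proj₂)
open import Data.Sum using (_⊎_; inj₁; inj₂; [_,_]′)
open import Data.Unit using (⊤; tt)
open import Data.Vec.Functional using (_∷_; [])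
open import Function.Bundles using (Injection; mk⇔)
open import Function.Definitions using (Injective)
open import Function.Properties.Inverse using (↔⇒↣)
open import Relation.Binary.Definitions using (Tri; tri<; tri≈; tri>)
open import Relation.Binary.PropositionalEquality
  using (_≡_; _≢_; refl; sym; trans; cong; cong₂; subst; module ≡-Reasoning)
open import Relation.Nullary using (¬_; Dec; yes; no; does)
open import Relation.Nullary.Decidable using (¬?; _×-dec_; _⊎-dec_; T?; from-yes; dec⇒maybe)

CanRaise CanLower : Fin 3 → Set
CanRaise x = toℕ x <ℕ 2
CanLower x = 0 <ℕ toℕ x

Switch : ∀ {m n} → TMatrix m n → Fin m → Fin m → Fin n → Fin n → Set
Switch M a a' b b' =
  a ≢ a' × b ≢ b' ×
  CanRaise (M a b) × CanRaise (M a' b') × CanLower (M a b') × CanLower (M a' b)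

SwitchFree : ∀ {m n} → TMatrix m n → Set
SwitchFree {m} {n} M = ∀ (a a' : Fin m) (b b' : Fin n) → ¬ Switch M a a' b b'

sum-cong : ∀ k {f g : Fin k → ℕ} → (∀ j → f j ≡ g j) → sumFin k f ≡ sumFin k g
sum-cong zero    f≗g = refl
sum-cong (suc k) f≗g = cong₂ _+_ (f≗g zero) (sum-cong k (λ j → f≗g (suc j)))

sum-mono : ∀ k {f g : Fin k → ℕ} → (∀ j → f j ≤ g j) → sumFin k f ≤ sumFin k g
sum-mono zero    f≤g = z≤n
sum-mono (suc k) f≤g = +-mono-≤ (f≤g zero) (sum-mono k (λ j → f≤g (suc j)))

sum-strict : ∀ k {f g : Fin k → ℕ} → (∀ j → f j ≤ g j) → ∀ x → f x <ℕ g x →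
             sumFin k f <ℕ sumFin k g
sum-strict (suc k) f≤g zero    fx<gx = +-mono-<-≤ fx<gx (sum-mono k (λ j → f≤g (suc j)))
sum-strict (suc k) f≤g (suc x) fx<gx =
  +-mono-≤-< (f≤g zero) (sum-strict k (λ j → f≤g (suc j)) x fx<gx)

sum-+ : ∀ k (f g : Fin k → ℕ) → sumFin k (λ j → f j + g j) ≡ sumFin k f + sumFin k g
sum-+ zero    f g = refl
sum-+ (suc k) f g =
  trans (cong (f zero + g zero +_) (sum-+ k (λ j → f (suc j)) (λ j → g (suc j))))
        (interchange +-commutativeSemigroup (f zero) (g zero) _ _)

compensation : ∀ k (f g : Fin k → ℕ) → sumFin k f ≡ sumFin k g →
               ∀ x → f x <ℕ g x → ∃ λ y → g y <ℕ f y
compensation k f g Σf≡Σg x fx<gx with any? (λ y → g y <? f y)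
... | yes found = found
... | no none =
  ⊥-elim (<⇒≢ℕ (sum-strict k (λ y → ≮⇒≥ (λ gy<fy → none (y , gy<fy))) x fx<gx) Σf≡Σg)

dominated-eq : ∀ k (f g : Fin k → ℕ) → (∀ j → f j ≤ g j) → sumFin k g ≤ sumFin k f →
               ∀ j → f j ≡ g j
dominated-eq k f g f≤g Σg≤Σf j =
  ≤-antisym (f≤g j) (≮⇒≥ (λ fj<gj → ≤⇒≯ Σg≤Σf (sum-strict k f≤g j fj<gj)))

δ : ∀ {k} → Fin k → Fin k → ℕ
δ u j = if does (j ≟ u) then 1 else 0

sum-δ : ∀ k (u : Fin k) → sumFin k (δ u) ≡ 1
sum-δ (suc k) zero    = cong suc (sum-zero k)
  where
  sum-zero : ∀ k → sumFin k (λ _ → 0) ≡ 0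
  sum-zero zero    = refl
  sum-zero (suc k) = sum-zero k
sum-δ (suc k) (suc u) = sum-δ k u

max-weight : ∀ k (P : Fin k → Set) → (∀ x → Dec (P x)) → (w : Fin k → ℕ) →
             (∀ x → ¬ P x) ⊎ (∃ λ x → P x × (∀ y → P y → w y ≤ w x))
max-weight zero    P P? w = inj₁ (λ ())
max-weight (suc k) P P? w
  with max-weight k (λ x → P (suc x)) (λ x → P? (suc x)) (λ x → w (suc x)) | P? zero
... | inj₁ none | no ¬p0 = inj₁ λ { zero p → ¬p0 p ; (suc x) p → none x p }
... | inj₁ none | yes p0 = inj₂ (zero , p0 , λ { zero _ → ≤-refl ; (suc y) q → ⊥-elim (none y q) })
... | inj₂ (x , px , max) | no ¬p0 = inj₂ (suc x , px , λ { zero q → ⊥-elim (¬p0 q) ; (suc y) q → max y q })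
... | inj₂ (x , px , max) | yes p0 with w zero ≤? w (suc x)
...   | yes w0≤ = inj₂ (suc x , px , λ { zero _ → w0≤ ; (suc y) q → max y q })
...   | no w0≰ = inj₂ (zero , p0 , λ { zero _ → ≤-refl ; (suc y) q → ≤-trans (max y q) (≰⇒≥ w0≰) })

data Role : Set where
  raise lower keep : Role

move : Role → Fin 3 → Fin 3
move raise zero             = 1F
move raise (suc zero)       = two
move raise (suc (suc zero)) = two
move lower zero             = zero
move lower (suc zero)       = zero
move lower (suc (suc zero)) = 1F
move keep  x                = x

move-raise : ∀ x → CanRaise x → toℕ (move raise x) ≡ suc (toℕ x)
move-raise zero       _ = refl
move-raise (suc zero) _ = refl
move-raise (suc (suc zero)) (s≤s (s≤s ()))

move-lower : ∀ x → CanLower x → suc (toℕ (move lower x)) ≡ toℕ x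
move-lower (suc zero)       _ = refl
move-lower (suc (suc zero)) _ = refl

role : ∀ {k} → Fin k → Fin k → Fin k → Role
role u v j with j ≟ u | j ≟ v
... | yes _ | _     = raise
... | no _  | yes _ = lower
... | no _  | no _  = keep

role-self : ∀ {k} (u v : Fin k) → role u v u ≡ raise
role-self u v with u ≟ u | u ≟ v
... | yes _  | _ = refl
... | no u≢u | _ = ⊥-elim (u≢u refl)

opposite : Role → Role
opposite raise = lower
opposite lower = raise
opposite keep  = keep

role-swap : ∀ {k} {u v : Fin k} → u ≢ v → ∀ j → opposite (role u v j) ≡ role v u j
role-swap {u = u} {v} u≢v j with j ≟ u | j ≟ v
... | yes refl | yes refl = ⊥-elim (u≢v refl)
... | yes _    | no _     = refl
... | no _     | yes _    = refl
... | no _     | no _     = refl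

move-pointwise : ∀ {k} (f : Fin k → Fin 3) {u v : Fin k} → u ≢ v →
  CanRaise (f u) → CanLower (f v) →
  ∀ j → toℕ (move (role u v j) (f j)) + δ v j ≡ toℕ (f j) + δ u j
move-pointwise f {u} {v} u≢v up down j with j ≟ u | j ≟ v
... | yes refl | yes refl = ⊥-elim (u≢v refl)
... | yes refl | no _ =
  trans (+-identityʳ _) (trans (move-raise (f j) up) (+-comm 1 (toℕ (f j))))
... | no _ | yes refl = trans (+-comm _ 1) (trans (move-lower (f j) down) (sym (+-identityʳ _)))
... | no _ | no _ = refl

transfer-sum : ∀ k (f : Fin k → Fin 3) {u v : Fin k} → u ≢ v →
  CanRaise (f u) → CanLower (f v) →
  sumFin k (λ j → toℕ (move (role u v j) (f j))) ≡ sumFin k (λ j → toℕ (f j))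
transfer-sum k f {u} {v} u≢v up down = +-cancelʳ-≡ 1 _ _ (begin
  sumFin k moved + 1                           ≡⟨ cong (sumFin k moved +_) (sum-δ k v) ⟨
  sumFin k moved + sumFin k (δ v)              ≡⟨ sum-+ k moved (δ v) ⟨
  sumFin k (λ j → moved j + δ v j)             ≡⟨ sum-cong k (move-pointwise f u≢v up down) ⟩
  sumFin k (λ j → toℕ (f j) + δ u j)           ≡⟨ sum-+ k (λ j → toℕ (f j)) (δ u) ⟩
  sumFin k (λ j → toℕ (f j)) + sumFin k (δ u)  ≡⟨ cong (sumFin k (λ j → toℕ (f j)) +_) (sum-δ k u) ⟩
  sumFin k (λ j → toℕ (f j)) + 1               ∎)
  where
  open ≡-Reasoning
  moved : Fin k → ℕ
  moved j = toℕ (move (role u v j) (f j))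

-- The role of an entry is the row role acting on the column role.
_⊗_ : Role → Role → Role
raise ⊗ r = r
lower ⊗ r = opposite r
keep  ⊗ r = keep

-- The combination is symmetric, so columns behave like rows.
⊗-comm : ∀ ρ r → ρ ⊗ r ≡ r ⊗ ρ
⊗-comm raise raise = refl
⊗-comm raise lower = refl
⊗-comm raise keep  = refl
⊗-comm lower raise = refl
⊗-comm lower lower = refl
⊗-comm lower keep  = refl
⊗-comm keep  raise = refl
⊗-comm keep  lower = refl
⊗-comm keep  keep  = refl

Movable : Role → Fin 3 → Fin 3 → Set
Movable raise x y = CanRaise x × CanLower y
Movable lower x y = CanLower x × CanRaise y
Movable keep  x y = ⊤

line-sum : ∀ k (ρ : Role) (f : Fin k → Fin 3) {u v : Fin k} → u ≢ v →
  Movable ρ (f u) (f v) →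
  sumFin k (λ j → toℕ (move (ρ ⊗ role u v j) (f j))) ≡ sumFin k (λ j → toℕ (f j))
line-sum k raise f u≢v (up , down) = transfer-sum k f u≢v up down
line-sum k lower f u≢v (down , up) =
  trans (sum-cong k (λ j → cong (λ r → toℕ (move r (f j))) (role-swap u≢v j)))
        (transfer-sum k f (λ v≡u → u≢v (sym v≡u)) up down)
line-sum k keep  f u≢v _ = refl

-- Perform the switch on rows a, a' and columns b, b': entry (i,j) gets the role
-- role a a' i ⊗ role b b' j, i.e. raise at (a,b), (a',b'), lower at (a,b'), (a',b).
exchange : ∀ {m n} → TMatrix m n → Fin m → Fin m → Fin n → Fin n → TMatrix m n
exchange M a a' b b' i j = move (role a a' i ⊗ role b b' j) (M i j)

-- Exchange lemma: a switch yields a different matrix with the same line sums.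
switch⇒¬lonesum : ∀ {m n} (M : TMatrix m n) {a a' b b'} → Switch M a a' b b' → ¬ Lonesum M
switch⇒¬lonesum {m} {n} M {a} {a'} {b} {b'}
  (a≢a' , b≢b' , up-ab , up-a'b' , down-ab' , down-a'b) lonesum =
  1+n≢n (trans (sym (move-raise (M a b) up-ab)) (cong toℕ raised-entry-kept))
  where
  N = exchange M a a' b b'

  row-movable : ∀ i → Movable (role a a' i) (M i b) (M i b')
  row-movable i with i ≟ a | i ≟ a'
  ... | yes refl | _        = up-ab , down-ab'
  ... | no _     | yes refl = down-a'b , up-a'b'
  ... | no _     | no _     = tt

  col-movable : ∀ j → Movable (role b b' j) (M a j) (M a' j)
  col-movable j with j ≟ b | j ≟ b'
  ... | yes refl | _        = up-ab , down-a'b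
  ... | no _     | yes refl = down-ab' , up-a'b'
  ... | no _     | no _     = tt

  rows : ∀ i → rowSum N i ≡ rowSum M i
  rows i = line-sum n (role a a' i) (M i) b≢b' (row-movable i)

  cols : ∀ j → colSum N j ≡ colSum M j
  cols j = trans
    (sum-cong m (λ i → cong (λ r → toℕ (move r (M i j))) (⊗-comm (role a a' i) (role b b' j))))
    (line-sum m (role b b' j) (λ i → M i j) a≢a' (col-movable j))

  -- N raises the entry (a,b), yet lonesumness forces N a b = M a b.
  raised-entry-kept : move raise (M a b) ≡ M a b
  raised-entry-kept =
    trans (cong₂ (λ r s → move (r ⊗ s) (M a b)) (sym (role-self a a')) (sym (role-self b b')))
          (lonesum N rows cols a b)

lonesum⇒switchFree : ∀ {m n} (M : TMatrix m n) → Lonesum M → SwitchFree M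
lonesum⇒switchFree M lonesum a a' b b' switch = switch⇒¬lonesum M switch lonesum

dominated : ∀ {m n} (M : TMatrix m n) → SwitchFree M → ∀ {x y c} → x ≢ y →
  CanRaise (M x c) → CanLower (M y c) → ∀ j → toℕ (M x j) ≤ toℕ (M y j)
dominated M free {x} {y} {c} x≢y up down j with j ≟ c
... | yes refl = ≤-trans (≤-pred up) down
... | no j≢c with toℕ (M y j) <? 2 | 0 <? toℕ (M x j)
...   | no y-full  | _         = ≤-trans (≤-pred (toℕ<n (M x j))) (≮⇒≥ y-full)
...   | yes _      | no x-empty = ≤-trans (≮⇒≥ x-empty) z≤n
...   | yes y-up   | yes x-down =
  ⊥-elim (free x y c j (x≢y , (λ c≡j → j≢c (sym c≡j)) , up , y-up , x-down , down))

module SameLineSums {m n} (M : TMatrix m n) (free : SwitchFree M) (N : TMatrix m n)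
  (rows : ∀ i → rowSum N i ≡ rowSum M i) (cols : ∀ j → colSum N j ≡ colSum M j) where

  Excess Deficit : Fin m → Fin n → Set
  Excess  r c = toℕ (M r c) <ℕ toℕ (N r c)
  Deficit r c = toℕ (N r c) <ℕ toℕ (M r c)

  excess⇒canRaise : ∀ {r c} → Excess r c → CanRaise (M r c)
  excess⇒canRaise {r} {c} ex = <-≤-trans ex (≤-pred (toℕ<n (N r c)))

  deficit⇒canLower : ∀ {r c} → Deficit r c → CanLower (M r c)
  deficit⇒canLower de = ≤-<-trans z≤n de

  excess-row-≢ : ∀ {r r' c} → Excess r c → Deficit r' c → r ≢ r'
  excess-row-≢ ex de refl = <-asym ex de

  excess-col-≢ : ∀ {r c c'} → Excess r c → Deficit r c' → c ≢ c'
  excess-col-≢ ex de refl = <-asym ex de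

  deficit-in-column : ∀ {r c} → Excess r c → ∃ λ r' → Deficit r' c
  deficit-in-column {r} {c} = compensation m (λ i → toℕ (M i c)) (λ i → toℕ (N i c)) (sym (cols c)) r

  excess-in-row : ∀ {r c} → Deficit r c → ∃ λ c' → Excess r c'
  excess-in-row {r} {c} = compensation n (λ j → toℕ (N r j)) (λ j → toℕ (M r j)) (rows r) c

  dominated-by : ∀ {r r' c} → Excess r c → Deficit r' c → ∀ j → toℕ (M r j) ≤ toℕ (M r' j)
  dominated-by ex de = dominated M free (excess-row-≢ ex de) (excess⇒canRaise ex) (deficit⇒canLower de)

  HasExcess : Fin m → Set
  HasExcess r = ∃ (Excess r)

  -- Take r with an excess at c and maximal row sum; along column c a deficit row r',
  -- along row r' an excess column c', along column c' a deficit row r''.  Maximality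
  -- makes rows r, r', r'' of M equal, and then (r', r''; c', c) is a switch.
  no-excess : ∀ i j → ¬ Excess i j
  no-excess i j ex
    with max-weight m HasExcess (λ r → any? (λ c → toℕ (M r c) <? toℕ (N r c))) (rowSum M)
  ... | inj₁ none = none i (j , ex)
  ... | inj₂ (r , (c , ex-rc) , maximal)
    with deficit-in-column ex-rc
  ... | r' , de-r'c with excess-in-row de-r'c
  ... | c' , ex-r'c' with deficit-in-column ex-r'c'
  ... | r'' , de-r''c' =
    free r' r'' c' c
      ( excess-row-≢ ex-r'c' de-r''c' , excess-col-≢ ex-r'c' de-r'c
      , excess⇒canRaise ex-r'c' , subst (_<ℕ 2) (trans (r≡r' c) (r'≡r'' c)) (excess⇒canRaise ex-rc)
      , deficit⇒canLower de-r'c , deficit⇒canLower de-r''c' )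
    where
    -- r' has an excess, so by maximality it cannot outweigh the row r it dominates.
    r≡r' : ∀ j → toℕ (M r j) ≡ toℕ (M r' j)
    r≡r' = dominated-eq n _ _ (dominated-by ex-rc de-r'c) (maximal r' (c' , ex-r'c'))
    -- Likewise r'' dominates r', and weighs no more than r, which r' dominates.
    r'≡r'' : ∀ j → toℕ (M r' j) ≡ toℕ (M r'' j)
    r'≡r'' = dominated-eq n _ _ (dominated-by ex-r'c' de-r''c')
      (≤-trans (maximal r'' (excess-in-row de-r''c')) (sum-mono n (dominated-by ex-rc de-r'c)))

  -- A deficit would force an excess in its row, so N and M agree everywhere.
  agrees : ∀ i j → N i j ≡ M i j
  agrees i j = toℕ-injective (≤-antisym
    (≮⇒≥ (no-excess i j))
    (≮⇒≥ (λ de → let (c' , ex) = excess-in-row de in no-excess i c' ex)))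

switchFree⇒lonesum : ∀ {m n} (M : TMatrix m n) → SwitchFree M → Lonesum M
switchFree⇒lonesum M free N rows cols = SameLineSums.agrees M free N rows cols

switch-restrict : ∀ {p q m n} {N : TMatrix p q} {M : TMatrix m n} {f : Fin p → Fin m} {g : Fin q → Fin n} →
  (∀ r c → N r c ≡ M (f r) (g c)) →
  ∀ {a a' b b'} → Switch M (f a) (f a') (g b) (g b') → Switch N a a' b b'
switch-restrict {f = f} {g} N≗M {a} {a'} {b} {b'} (fa≢fa' , gb≢gb' , up₁ , up₂ , down₁ , down₂) =
  (λ a≡a' → fa≢fa' (cong f a≡a')) , (λ b≡b' → gb≢gb' (cong g b≡b'))
  , subst CanRaise (sym (N≗M a b)) up₁ , subst CanRaise (sym (N≗M a' b')) up₂
  , subst CanLower (sym (N≗M a b')) down₁ , subst CanLower (sym (N≗M a' b)) down₂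

switchFree-reindex : ∀ {p q m n} {N : TMatrix p q} {M : TMatrix m n} {f : Fin p → Fin m} {g : Fin q → Fin n} →
  Injective _≡_ _≡_ f → Injective _≡_ _≡_ g → (∀ r c → N r c ≡ M (f r) (g c)) →
  SwitchFree M → SwitchFree N
switchFree-reindex {f = f} {g} f-inj g-inj N≗M free a a' b b' (a≢a' , b≢b' , up₁ , up₂ , down₁ , down₂) =
  free (f a) (f a') (g b) (g b')
    ( (λ e → a≢a' (f-inj e)) , (λ e → b≢b' (g-inj e))
    , subst CanRaise (N≗M a b) up₁ , subst CanRaise (N≗M a' b') up₂
    , subst CanLower (N≗M a b') down₁ , subst CanLower (N≗M a' b) down₂ )

sub2-reindex : ∀ {m n} (M : TMatrix m n) i₁ i₂ j₁ j₂ →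
  ∀ r c → sub2 M i₁ i₂ j₁ j₂ r c ≡ M ((i₁ ∷ i₂ ∷ []) r) ((j₁ ∷ j₂ ∷ []) c)
sub2-reindex M i₁ i₂ j₁ j₂ 0F 0F = refl
sub2-reindex M i₁ i₂ j₁ j₂ 0F 1F = refl
sub2-reindex M i₁ i₂ j₁ j₂ 1F 0F = refl
sub2-reindex M i₁ i₂ j₁ j₂ 1F 1F = refl

pair-injective : ∀ {k} {x y : Fin k} → x ≢ y → Injective _≡_ _≡_ (x ∷ y ∷ [])
pair-injective x≢y {0F} {0F} _ = refl
pair-injective x≢y {0F} {1F} x≡y = ⊥-elim (x≢y x≡y)
pair-injective x≢y {1F} {0F} y≡x = ⊥-elim (x≢y (sym y≡x))
pair-injective x≢y {1F} {1F} _ = refl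

switch? : ∀ {m n} (M : TMatrix m n) a a' b b' → Dec (Switch M a a' b b')
switch? M a a' b b' =
  ¬? (a ≟ a') ×-dec ¬? (b ≟ b') ×-dec
  (toℕ (M a b) <? 2) ×-dec (toℕ (M a' b') <? 2) ×-dec (0 <? toℕ (M a b')) ×-dec (0 <? toℕ (M a' b))

switchFree? : ∀ {m n} (M : TMatrix m n) → Dec (SwitchFree M)
switchFree? M = all? λ a → all? λ a' → all? λ b → all? λ b' → ¬? (switch? M a a' b b')

patterns-switchFree : ∀ x y →
  SwitchFree (mk2 two two x y) × SwitchFree (mk2 two x two y) × SwitchFree (mk2 two x y zero3) ×
  SwitchFree (mk2 x y zero3 zero3) × SwitchFree (mk2 x zero3 y zero3)
patterns-switchFree = from-yes (all? λ x → all? λ y →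
  switchFree? (mk2 two two x y) ×-dec switchFree? (mk2 two x two y) ×-dec
  switchFree? (mk2 two x y zero3) ×-dec switchFree? (mk2 x y zero3 zero3) ×-dec
  switchFree? (mk2 x zero3 y zero3))

≐-switchFree : ∀ {N N'} → N ≐ N' → SwitchFree N' → SwitchFree N
≐-switchFree N≐N' = switchFree-reindex {f = λ r → r} {g = λ c → c} (λ e → e) (λ e → e) N≐N'

pattern⇒switchFree : ∀ {P} → Pattern P → SwitchFree P
pattern⇒switchFree (inj₁ (x , y , P≐)) = ≐-switchFree P≐ (patterns-switchFree x y .proj₁)
pattern⇒switchFree (inj₂ (inj₁ (x , y , P≐))) = ≐-switchFree P≐ (patterns-switchFree x y .proj₂ .proj₁)
pattern⇒switchFree (inj₂ (inj₂ (inj₁ (x , y , P≐)))) =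
  ≐-switchFree P≐ (patterns-switchFree x y .proj₂ .proj₂ .proj₁)
pattern⇒switchFree (inj₂ (inj₂ (inj₂ (inj₁ (x , y , P≐))))) =
  ≐-switchFree P≐ (patterns-switchFree x y .proj₂ .proj₂ .proj₂ .proj₁)
pattern⇒switchFree (inj₂ (inj₂ (inj₂ (inj₂ (x , y , P≐))))) =
  ≐-switchFree P≐ (patterns-switchFree x y .proj₂ .proj₂ .proj₂ .proj₂)

permutation-injective : ∀ {k} (σ : Permutation′ k) → Injective _≡_ _≡_ (σ ⟨$⟩ʳ_)
permutation-injective σ = Injection.injective (↔⇒↣ σ)

admissible⇒switchFree : ∀ {N} → Admissible N → SwitchFree N
admissible⇒switchFree (P , pat , σ , τ , N≗P) =
  switchFree-reindex {f = σ ⟨$⟩ʳ_} {g = τ ⟨$⟩ʳ_}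
    (permutation-injective σ) (permutation-injective τ) N≗P (pattern⇒switchFree pat)

mk2-entries : ∀ {P : M2} {a b c d} →
  P 0F 0F ≡ a → P 0F 1F ≡ b → P 1F 0F ≡ c → P 1F 1F ≡ d → P ≐ mk2 a b c d
mk2-entries e₀₀ e₀₁ e₁₀ e₁₁ 0F 0F = e₀₀
mk2-entries e₀₀ e₀₁ e₁₀ e₁₁ 0F 1F = e₀₁
mk2-entries e₀₀ e₀₁ e₁₀ e₁₁ 1F 0F = e₁₀
mk2-entries e₀₀ e₀₁ e₁₀ e₁₁ 1F 1F = e₁₁

pattern? : (P : M2) → Maybe (Pattern P)
pattern? P =
      map (λ { (e₀₀ , e₀₁) → inj₁ (_ , _ , mk2-entries e₀₀ e₀₁ refl refl) })
          (dec⇒maybe (P 0F 0F ≟ two ×-dec P 0F 1F ≟ two))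
  <∣> map (λ { (e₀₀ , e₁₀) → inj₂ (inj₁ (_ , _ , mk2-entries e₀₀ refl e₁₀ refl)) })
          (dec⇒maybe (P 0F 0F ≟ two ×-dec P 1F 0F ≟ two))
  <∣> map (λ { (e₀₀ , e₁₁) → inj₂ (inj₂ (inj₁ (_ , _ , mk2-entries e₀₀ refl refl e₁₁))) })
          (dec⇒maybe (P 0F 0F ≟ two ×-dec P 1F 1F ≟ zero3))
  <∣> map (λ { (e₁₀ , e₁₁) → inj₂ (inj₂ (inj₂ (inj₁ (_ , _ , mk2-entries refl refl e₁₀ e₁₁)))) })
          (dec⇒maybe (P 1F 0F ≟ zero3 ×-dec P 1F 1F ≟ zero3))
  <∣> map (λ { (e₀₁ , e₁₁) → inj₂ (inj₂ (inj₂ (inj₂ (_ , _ , mk2-entries refl e₀₁ refl e₁₁)))) })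
          (dec⇒maybe (P 0F 1F ≟ zero3 ×-dec P 1F 1F ≟ zero3))

permute : Permutation′ 2 → Permutation′ 2 → M2 → M2
permute σ τ N r c = N (σ ⟨$⟩ˡ r) (τ ⟨$⟩ˡ c)

permute-equiv : ∀ σ τ N → Equiv2 N (permute σ τ N)
permute-equiv σ τ N = σ , τ , λ r c → sym (cong₂ N (inverseˡ σ) (inverseˡ τ))

classify : (N : M2) → Maybe (Admissible N)
classify N = try idₚ idₚ <∣> try idₚ swap <∣> try swap idₚ <∣> try swap swap
  where
  swap : Permutation′ 2
  swap = transpose 0F 1F
  try : Permutation′ 2 → Permutation′ 2 → Maybe (Admissible N)
  try σ τ = map (λ pat → permute σ τ N , pat , permute-equiv σ τ N) (pattern? (permute σ τ N))

classify-complete : ∀ a b c d → ¬ SwitchFree (mk2 a b c d) ⊎ T (is-just (classify (mk2 a b c d)))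
classify-complete = from-yes (all? λ a → all? λ b → all? λ c → all? λ d →
  ¬? (switchFree? (mk2 a b c d)) ⊎-dec T? (is-just (classify (mk2 a b c d))))

switchFree⇒admissible : ∀ a b c d → SwitchFree (mk2 a b c d) → Admissible (mk2 a b c d)
switchFree⇒admissible a b c d free =
  [ (λ has-switch → ⊥-elim (has-switch free)) , to-witness-T (classify (mk2 a b c d)) ]′
  (classify-complete a b c d)

submatrix-switchFree : ∀ {m n} (M : TMatrix m n) → SwitchFree M →
  ∀ {i₁ i₂ j₁ j₂} → i₁ ≢ i₂ → j₁ ≢ j₂ → SwitchFree (sub2 M i₁ i₂ j₁ j₂)
submatrix-switchFree M free {i₁} {i₂} {j₁} {j₂} i₁≢i₂ j₁≢j₂ =
  switchFree-reindex (pair-injective i₁≢i₂) (pair-injective j₁≢j₂) (sub2-reindex M i₁ i₂ j₁ j₂) free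

-- A switch of M lies in the ordered submatrix on its two rows and two columns.
submatrices⇒switchFree : ∀ {m n} (M : TMatrix m n) →
  (∀ i₁ i₂ j₁ j₂ → i₁ < i₂ → j₁ < j₂ → SwitchFree (sub2 M i₁ i₂ j₁ j₂)) → SwitchFree M
submatrices⇒switchFree M free a a' b b' switch@(a≢a' , b≢b' , _) = by-order (<-cmp a a') (<-cmp b b')
  where
  in-submatrix : ∀ i₁ i₂ j₁ j₂ {r r' c c'} →
    Switch M ((i₁ ∷ i₂ ∷ []) r) ((i₁ ∷ i₂ ∷ []) r') ((j₁ ∷ j₂ ∷ []) c) ((j₁ ∷ j₂ ∷ []) c') →
    Switch (sub2 M i₁ i₂ j₁ j₂) r r' c c'
  in-submatrix i₁ i₂ j₁ j₂ =
    switch-restrict {M = M} {f = i₁ ∷ i₂ ∷ []} {g = j₁ ∷ j₂ ∷ []} (sub2-reindex M i₁ i₂ j₁ j₂)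

  by-order : Tri (a < a') (a ≡ a') (a' < a) → Tri (b < b') (b ≡ b') (b' < b) → ⊥
  by-order (tri≈ _ a≡a' _) _                = a≢a' a≡a'
  by-order _                (tri≈ _ b≡b' _) = b≢b' b≡b'
  by-order (tri< a<a' _ _) (tri< b<b' _ _) = free a a' b b' a<a' b<b' 0F 1F 0F 1F (in-submatrix a a' b b' switch)
  by-order (tri< a<a' _ _) (tri> _ _ b'<b) = free a a' b' b a<a' b'<b 0F 1F 1F 0F (in-submatrix a a' b' b switch)
  by-order (tri> _ _ a'<a) (tri< b<b' _ _) = free a' a b b' a'<a b<b' 1F 0F 0F 1F (in-submatrix a' a b b' switch)
  by-order (tri> _ _ a'<a) (tri> _ _ b'<b) = free a' a b' b a'<a b'<b 1F 0F 1F 0F (in-submatrix a' a b' b switch)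

theorem3p1 : (m n : ℕ) (M : TMatrix m n) →
    Lonesum M ⇔ (∀ (i₁ i₂ : Fin m) (j₁ j₂ : Fin n) → i₁ < i₂ → j₁ < j₂ →
                   Admissible (sub2 M i₁ i₂ j₁ j₂))
theorem3p1 m n M = mk⇔ lonesum⇒admissible admissible⇒lonesum
  where
  lonesum⇒admissible : Lonesum M → ∀ i₁ i₂ j₁ j₂ → i₁ < i₂ → j₁ < j₂ → Admissible (sub2 M i₁ i₂ j₁ j₂)
  lonesum⇒admissible lonesum i₁ i₂ j₁ j₂ i₁<i₂ j₁<j₂ =
    switchFree⇒admissible _ _ _ _
      (submatrix-switchFree M (lonesum⇒switchFree M lonesum) (<⇒≢ i₁<i₂) (<⇒≢ j₁<j₂))

  admissible⇒lonesum : (∀ i₁ i₂ j₁ j₂ → i₁ < i₂ → j₁ < j₂ → Admissible (sub2 M i₁ i₂ j₁ j₂)) → Lonesum M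
  admissible⇒lonesum admissible = switchFree⇒lonesum M (submatrices⇒switchFree M
    (λ i₁ i₂ j₁ j₂ i₁<i₂ j₁<j₂ → admissible⇒switchFree (admissible i₁ i₂ j₁ j₂ i₁<i₂ j₁<j₂)))
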